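{- For every $n\ge 1$, let $G_n^8$ be the graph on vertex set $\{a,b,c,d\}\cup\{1,2,\dots,n\}\cup\{x\}$ with the following edges: among $\{a,b,c,d\}$ exactly the edges $\{a,c\},\{a,d\},\{b,c\},\{b,d\}$; among $\{1,\dots,n\}$ every pair $\{i,j\}$ with $|i-j|\ge 2$ (so the only non-edges there are $\{i,i+1\}$, $1\le i\le n-1$); the edges $\{x,i\}$ for all $1\le i\le n$, and $\{x,a\}$, $\{x,d\}$; the edges $\{a,i\}$ for all $2\le i\le n$; and the edges $\{d,i\}$ for all $1\le i\le n-1$. There are no other edges. Then $G_n^8$ is word-representable.
   Context: All graphs are finite and simple. For a word $w$ and letters $i,j$, let $w_{ij}$ be the subsequence of $w$ consisting of all occurrences of $i$ and $j$; $i$ and $j$ alternate in $w$ if $w_{ij}$ contains no factor $ii$ or $jj$. A graph $G$ is word-representable if there is a word $w$ over $V(G)$ such that for all distinct $i,j\in V(G)$, $\{i,j\}\in E(G)$ if and only if $i$ and $j$ alternate in $w$. -}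

module Defs where

open import Data.Nat using (ℕ; zero; suc; _+_; _≤_; _<_)
open import Data.Fin using (Fin; toℕ)
open import Data.List using (List; []; _∷_; filter)
open import Data.Product using (Σ; _×_; _,_)
open import Data.Sum using (_⊎_)
open import Data.Empty using (⊥)
open import Relation.Nullary using (¬_; Dec; yes; no)
open import Relation.Binary.PropositionalEquality using (_≡_; _≢_; refl)
import Data.Fin as Fin
open import Relation.Binary.Definitions using (DecidableEquality)
open import Relation.Unary using (Pred; Decidable)
open import Function.Bundles using (_⇔_)
open import Relation.Nullary.Decidable using (_⊎-dec_)
open import Level using (0ℓ)

restrict : {V : Set} → DecidableEquality V → V → V → List V → List V
restrict _≟_ i j = filter (λ y → (y ≟ i) ⊎-dec (y ≟ j))

data HasSquare {V : Set} : List V → Set where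
  here  : ∀ {y ys} → HasSquare (y ∷ y ∷ ys)
  there : ∀ {y ys} → HasSquare ys → HasSquare (y ∷ ys)

Alternate : {V : Set} → DecidableEquality V → List V → V → V → Set
Alternate _≟_ w i j = ¬ HasSquare (restrict _≟_ i j w)

WordRepresentable : (V : Set) → DecidableEquality V → (V → V → Set) → Set
WordRepresentable V _≟_ Adj =
  Σ (List V) λ w → ∀ (i j : V) → i ≢ j → (Adj i j ⇔ Alternate _≟_ w i j)

-- Vertex set of G_n^8: {a,b,c,d} ∪ {1,…,n} ∪ {x}; vertex (num k) with k : Fin n
-- stands for the integer toℕ k + 1.
data V8 (n : ℕ) : Set where
  a b c d x : V8 n
  num : Fin n → V8 n

lab : {n : ℕ} → Fin n → ℕ
lab k = suc (toℕ k)

Far : ℕ → ℕ → Set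
Far i j = (2 + i ≤ j) ⊎ (2 + j ≤ i)

data E8 (n : ℕ) : V8 n → V8 n → Set where
  ac : E8 n a c
  ad : E8 n a d
  bc : E8 n b c
  bd : E8 n b d
  ij : ∀ {k l : Fin n} → Far (lab k) (lab l) → E8 n (num k) (num l)
  xi : ∀ {k : Fin n} → E8 n x (num k)
  xa : E8 n x a
  xd : E8 n x d
  ai : ∀ {k : Fin n} → 2 ≤ lab k → E8 n a (num k)
  di : ∀ {k : Fin n} → lab k + 1 ≤ n → E8 n d (num k)

Adj8 : (n : ℕ) → V8 n → V8 n → Set
Adj8 n u v = E8 n u v ⊎ E8 n v u

_≟8_ : {n : ℕ} → DecidableEquality (V8 n)
a ≟8 a = yes refl
b ≟8 b = yes refl
c ≟8 c = yes refl
d ≟8 d = yes refl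
x ≟8 x = yes refl
num k ≟8 num l with k Fin.≟ l
... | yes refl = yes refl
... | no k≢l = no λ { refl → k≢l refl }
a ≟8 b = no λ ()
a ≟8 c = no λ ()
a ≟8 d = no λ ()
a ≟8 x = no λ ()
a ≟8 num _ = no λ ()
b ≟8 a = no λ ()
b ≟8 c = no λ ()
b ≟8 d = no λ ()
b ≟8 x = no λ ()
b ≟8 num _ = no λ ()
c ≟8 a = no λ ()
c ≟8 b = no λ ()
c ≟8 d = no λ ()
c ≟8 x = no λ ()
c ≟8 num _ = no λ ()
d ≟8 a = no λ ()
d ≟8 b = no λ ()
d ≟8 c = no λ ()
d ≟8 x = no λ ()
d ≟8 num _ = no λ ()
x ≟8 a = no λ ()
x ≟8 b = no λ ()
x ≟8 c = no λ ()
x ≟8 d = no λ ()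
x ≟8 num _ = no λ ()
num _ ≟8 a = no λ ()
num _ ≟8 b = no λ ()
num _ ≟8 c = no λ ()
num _ ≟8 d = no λ ()
num _ ≟8 x = no λ ()

{-# OPTIONS --safe #-}
module Submission where

-- The numbers are written as two permutations of 1 … n: E swaps 1↔2, 3↔4, … and O swaps
-- 2↔3, 4↔5, ….  Two numbers appear in the same order in E and in O iff they are not consecutive,
-- so in E O the non-consecutive pairs alternate while a consecutive pair leaves a square.  On the letters alone the word represents the
-- induced subgraph (a finite check); a, d and x occur between E and O but b and c do not, so every
-- number alternates with a, d, x and with neither b nor c.
-- An extra n before E and an extra 1 after O destroy exactly the alternations d–n and a–1, and
-- only prolong those among the numbers.

open import Defs
open import Data.Nat using (ℕ; zero; suc; _+_; _≤_; _<_; s≤s; z≤n)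
open import Data.Nat.Properties
  using (1+n≰n; m+1+n≰m; m+n≤o⇒n≤o; ≤∧≢⇒<; m≤n⇒m<n∨m≡n; ≤-trans; <⇒≤; +-comm)
  renaming (suc-injective to ℕ-suc-injective)
open import Data.Fin using (Fin; zero; suc; toℕ; fromℕ; _≟_)
open import Data.Fin.Properties using (suc-injective; toℕ-injective; toℕ-fromℕ; toℕ≤pred[n]; <-cmp)
open import Data.List using (List; []; _∷_; _++_; map; concat)
open import Data.List.Properties using (filter-++; filter-accept; filter-reject; filter-≐)
open import Data.Product using (_×_; _,_; proj₁; proj₂)
open import Data.Sum using (_⊎_; inj₁; inj₂; [_,_])
import Data.Sum as Sum
open import Data.Empty using (⊥-elim)
open import Function using (_∘_; id; case_of_)
open import Function.Bundles using (_⇔_; mk⇔; module Equivalence)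
open Equivalence using (to; from)
open import Relation.Binary.Definitions using (DecidableEquality; tri<; tri≈; tri>)
open import Relation.Binary.PropositionalEquality
  using (_≡_; _≢_; refl; sym; trans; cong; subst; subst₂; module ≡-Reasoning)
open ≡-Reasoning
open import Relation.Nullary using (¬_; yes; no)
open import Relation.Nullary.Decidable using (True; False; toWitness; toWitnessFalse; _⊎-dec_)
open import Relation.Unary using (Decidable)

module _ {A : Set} where

  HasSquare-++⁺ʳ : ∀ xs {ys : List A} → HasSquare ys → HasSquare (xs ++ ys)
  HasSquare-++⁺ʳ []       sq = sq
  HasSquare-++⁺ʳ (_ ∷ xs) sq = there (HasSquare-++⁺ʳ xs sq)

  hasSquare? : DecidableEquality A → Decidable (HasSquare {A})
  hasSquare? _≟ₐ_ []           = no λ ()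
  hasSquare? _≟ₐ_ (y ∷ [])     = no λ { (there ()) }
  hasSquare? _≟ₐ_ (y ∷ z ∷ ys) with y ≟ₐ z | hasSquare? _≟ₐ_ (z ∷ ys)
  ... | yes refl | _      = yes here
  ... | no _     | yes sq = yes (there sq)
  ... | no y≢z   | no ¬sq = no λ { here → y≢z refl ; (there sq) → ¬sq sq }

  alternation : A → A → ℕ → List A
  alternation u v zero    = []
  alternation u v (suc t) = u ∷ alternation v u t

  alternation-squareFree : ∀ {u v} → u ≢ v → ∀ t → ¬ HasSquare (alternation u v t)
  alternation-squareFree u≢v (suc zero)    (there ())
  alternation-squareFree u≢v (suc (suc t)) here       = u≢v refl
  alternation-squareFree u≢v (suc (suc t)) (there sq) = alternation-squareFree (u≢v ∘ sym) (suc t) sq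

  data Opposite (i j : A) : List A → List A → Set where
    ij-ji : Opposite i j (i ∷ j ∷ []) (j ∷ i ∷ [])
    ji-ij : Opposite i j (j ∷ i ∷ []) (i ∷ j ∷ [])

  Opposite-sym : ∀ {i j xs ys} → Opposite i j xs ys → Opposite i j ys xs
  Opposite-sym ij-ji = ji-ij
  Opposite-sym ji-ij = ij-ji

  Opposite⇒square : ∀ {i j xs ys} → Opposite i j xs ys → ∀ zs → HasSquare (xs ++ ys ++ zs)
  Opposite⇒square ij-ji zs = there here
  Opposite⇒square ji-ij zs = there here

  padded-ijij-squareFree : ∀ {i j ρ ρ′} → i ≢ j → ρ ≡ j ∷ [] ⊎ ρ ≡ [] → ρ′ ≡ i ∷ [] ⊎ ρ′ ≡ [] →
                           ¬ HasSquare (concat (ρ ∷ (i ∷ j ∷ i ∷ j ∷ []) ∷ ρ′ ∷ []))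
  padded-ijij-squareFree i≢j (inj₁ refl) (inj₁ refl) = alternation-squareFree (i≢j ∘ sym) 6
  padded-ijij-squareFree i≢j (inj₁ refl) (inj₂ refl) = alternation-squareFree (i≢j ∘ sym) 5
  padded-ijij-squareFree i≢j (inj₂ refl) (inj₁ refl) = alternation-squareFree i≢j 5
  padded-ijij-squareFree i≢j (inj₂ refl) (inj₂ refl) = alternation-squareFree i≢j 4

  padded-ijiji-squareFree : ∀ {i j ρ ρ′} → i ≢ j → ρ ≡ j ∷ [] ⊎ ρ ≡ [] → ρ′ ≡ j ∷ [] ⊎ ρ′ ≡ [] →
                            ¬ HasSquare (concat (ρ ∷ (i ∷ j ∷ i ∷ j ∷ i ∷ []) ∷ ρ′ ∷ []))
  padded-ijiji-squareFree i≢j (inj₁ refl) (inj₁ refl) = alternation-squareFree (i≢j ∘ sym) 7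
  padded-ijiji-squareFree i≢j (inj₁ refl) (inj₂ refl) = alternation-squareFree (i≢j ∘ sym) 6
  padded-ijiji-squareFree i≢j (inj₂ refl) (inj₁ refl) = alternation-squareFree i≢j 6
  padded-ijiji-squareFree i≢j (inj₂ refl) (inj₂ refl) = alternation-squareFree i≢j 5

Opposite-map : ∀ {A B : Set} (f : A → B) {i j xs ys} → Opposite i j xs ys →
               Opposite (f i) (f j) (map f xs) (map f ys)
Opposite-map f ij-ji = ij-ji
Opposite-map f ji-ij = ji-ij

insertSecond : {A : Set} → A → List A → List A
insertSecond z []       = z ∷ []
insertSecond z (y ∷ ys) = y ∷ z ∷ ys

module _ {A : Set} (_≟ₐ_ : DecidableEquality A) where

  private
    restrictₐ = restrict _≟ₐ_

  restrict-comm : ∀ i j w → restrictₐ i j w ≡ restrictₐ j i w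
  restrict-comm i j = filter-≐ (λ y → (y ≟ₐ i) ⊎-dec (y ≟ₐ j)) (λ y → (y ≟ₐ j) ⊎-dec (y ≟ₐ i))
                               (Sum.swap , Sum.swap)

  Alternate-sym : ∀ {w i j} → Alternate _≟ₐ_ w i j → Alternate _≟ₐ_ w j i
  Alternate-sym {w} {i} {j} alt = alt ∘ subst HasSquare (restrict-comm j i w)

  restrict-++ : ∀ i j xs ys → restrictₐ i j (xs ++ ys) ≡ restrictₐ i j xs ++ restrictₐ i j ys
  restrict-++ i j = filter-++ (λ y → (y ≟ₐ i) ⊎-dec (y ≟ₐ j))

  restrict-concat : ∀ i j (ws : List (List A)) →
                    restrictₐ i j (concat ws) ≡ concat (map (restrictₐ i j) ws)
  restrict-concat i j []       = refl
  restrict-concat i j (v ∷ ws) =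
    trans (restrict-++ i j v (concat ws)) (cong (restrictₐ i j v ++_) (restrict-concat i j ws))

  restrict-accept : ∀ {i j y} ys → y ≡ i ⊎ y ≡ j → restrictₐ i j (y ∷ ys) ≡ y ∷ restrictₐ i j ys
  restrict-accept {i} {j} _ = filter-accept (λ y → (y ≟ₐ i) ⊎-dec (y ≟ₐ j))

  restrict-reject : ∀ {i j y} ys → ¬ (y ≡ i ⊎ y ≡ j) → restrictₐ i j (y ∷ ys) ≡ restrictₐ i j ys
  restrict-reject {i} {j} _ = filter-reject (λ y → (y ≟ₐ i) ⊎-dec (y ≟ₐ j))

  restrict-insertSecond : ∀ {i j z} → ¬ (z ≡ i ⊎ z ≡ j) → ∀ ys →
                          restrictₐ i j (insertSecond z ys) ≡ restrictₐ i j ys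
  restrict-insertSecond z∉ []       = restrict-reject [] z∉
  restrict-insertSecond {i} {j} {z} z∉ (y ∷ ys) = begin
    restrictₐ i j ((y ∷ []) ++ z ∷ ys)               ≡⟨ restrict-++ i j (y ∷ []) (z ∷ ys) ⟩
    restrictₐ i j (y ∷ []) ++ restrictₐ i j (z ∷ ys) ≡⟨ cong (restrictₐ i j (y ∷ []) ++_) (restrict-reject ys z∉) ⟩
    restrictₐ i j (y ∷ []) ++ restrictₐ i j ys       ≡⟨ restrict-++ i j (y ∷ []) ys ⟨
    restrictₐ i j (y ∷ ys)                           ∎

  restrict-singleton : ∀ {i j} y → y ≢ i →
    (y ≡ j × restrictₐ i j (y ∷ []) ≡ j ∷ []) ⊎ (y ≢ j × restrictₐ i j (y ∷ []) ≡ [])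
  restrict-singleton {i} {j} y y≢i = case y ≟ₐ j of λ where
    (yes y≡j) → inj₁ (y≡j , trans (restrict-accept [] (inj₂ y≡j)) (cong (_∷ []) y≡j))
    (no y≢j)  → inj₂ (y≢j , restrict-reject [] [ y≢i , y≢j ])

  restrict-singleton′ : ∀ {i j} y → y ≢ j →
    (y ≡ i × restrictₐ i j (y ∷ []) ≡ i ∷ []) ⊎ (y ≢ i × restrictₐ i j (y ∷ []) ≡ [])
  restrict-singleton′ {i} {j} y y≢j = case y ≟ₐ i of λ where
    (yes y≡i) → inj₁ (y≡i , trans (restrict-accept [] (inj₁ y≡i)) (cong (_∷ []) y≡i))
    (no y≢i)  → inj₂ (y≢i , restrict-reject [] [ y≢i , y≢j ])

module _ {A B : Set} (_≟ₐ_ : DecidableEquality A) (_≟ᵦ_ : DecidableEquality B) (f : A → B) where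

  restrict-map : ∀ {u v k l} → (∀ y → (f y ≡ u ⊎ f y ≡ v) ⇔ (y ≡ k ⊎ y ≡ l)) → ∀ ys →
                 restrict _≟ᵦ_ u v (map f ys) ≡ map f (restrict _≟ₐ_ k l ys)
  restrict-map pre [] = refl
  restrict-map {u} {v} {k} {l} pre (y ∷ ys) with (y ≟ₐ k) ⊎-dec (y ≟ₐ l)
  ... | yes p = begin
    restrict _≟ᵦ_ u v (f y ∷ map f ys)   ≡⟨ restrict-accept _≟ᵦ_ _ (from (pre y) p) ⟩
    f y ∷ restrict _≟ᵦ_ u v (map f ys)   ≡⟨ cong (f y ∷_) (restrict-map pre ys) ⟩
    f y ∷ map f (restrict _≟ₐ_ k l ys)   ≡⟨ cong (map f) (restrict-accept _≟ₐ_ ys p) ⟨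
    map f (restrict _≟ₐ_ k l (y ∷ ys))   ∎
  ... | no ¬p = begin
    restrict _≟ᵦ_ u v (f y ∷ map f ys)   ≡⟨ restrict-reject _≟ᵦ_ _ (¬p ∘ to (pre y)) ⟩
    restrict _≟ᵦ_ u v (map f ys)         ≡⟨ restrict-map pre ys ⟩
    map f (restrict _≟ₐ_ k l ys)         ≡⟨ cong (map f) (restrict-reject _≟ₐ_ ys ¬p) ⟨
    map f (restrict _≟ₐ_ k l (y ∷ ys))   ∎

  restrict-map-none : ∀ {u v} → (∀ y → ¬ (f y ≡ u ⊎ f y ≡ v)) → ∀ ys → restrict _≟ᵦ_ u v (map f ys) ≡ []
  restrict-map-none ∉ []       = refl
  restrict-map-none ∉ (y ∷ ys) = trans (restrict-reject _≟ᵦ_ _ (∉ y)) (restrict-map-none ∉ ys)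

-- evenSwaps 5 = 1 0 3 2 4 and oddSwaps 5 = 0 2 1 4 3
evenSwaps : (n : ℕ) → List (Fin n)
oddSwaps  : (n : ℕ) → List (Fin n)
evenSwaps zero    = []
evenSwaps (suc n) = insertSecond zero (map suc (oddSwaps n))
oddSwaps zero     = []
oddSwaps (suc n)  = zero ∷ map suc (evenSwaps n)

module _ {n : ℕ} where

  restrict-suc-suc : ∀ {k l : Fin n} ys →
                     restrict _≟_ (suc k) (suc l) (map suc ys) ≡ map suc (restrict _≟_ k l ys)
  restrict-suc-suc = restrict-map _≟_ _≟_ suc λ _ →
    mk⇔ (Sum.map suc-injective suc-injective) (Sum.map (cong suc) (cong suc))

  restrict-zero-suc : ∀ {l : Fin n} ys →
                      restrict _≟_ zero (suc l) (map suc ys) ≡ map suc (restrict _≟_ l l ys)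
  restrict-zero-suc = restrict-map _≟_ _≟_ suc λ _ →
    mk⇔ [ (λ ()) , inj₁ ∘ suc-injective ] [ inj₂ ∘ cong suc , inj₂ ∘ cong suc ]

  restrict-zero-zero : (ys : List (Fin n)) → restrict _≟_ zero zero (map suc ys) ≡ []
  restrict-zero-zero = restrict-map-none _≟_ _≟_ suc λ _ → [ (λ ()) , (λ ()) ]

  restrict-evenSwaps-suc : ∀ {k l : Fin n} →
    restrict _≟_ (suc k) (suc l) (evenSwaps (suc n)) ≡ map suc (restrict _≟_ k l (oddSwaps n))
  restrict-evenSwaps-suc =
    trans (restrict-insertSecond _≟_ [ (λ ()) , (λ ()) ] (map suc (oddSwaps n)))
          (restrict-suc-suc (oddSwaps n))

  restrict-oddSwaps-suc : ∀ {k l : Fin n} →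
    restrict _≟_ (suc k) (suc l) (oddSwaps (suc n)) ≡ map suc (restrict _≟_ k l (evenSwaps n))
  restrict-oddSwaps-suc = restrict-suc-suc (evenSwaps n)

swaps-once : ∀ {n} (k : Fin n) →
  restrict _≟_ k k (evenSwaps n) ≡ k ∷ [] × restrict _≟_ k k (oddSwaps n) ≡ k ∷ []
swaps-once {suc zero}    zero    = refl , refl
swaps-once {suc (suc n)} zero    =
  cong (zero ∷_) (restrict-zero-zero (map suc (evenSwaps n))) ,
  cong (zero ∷_) (restrict-zero-zero (evenSwaps (suc n)))
swaps-once               (suc k) =
  trans restrict-evenSwaps-suc (cong (map suc) (proj₂ (swaps-once k))) ,
  trans restrict-oddSwaps-suc  (cong (map suc) (proj₁ (swaps-once k)))

swaps-far : ∀ {n} (k l : Fin n) → 2 + toℕ k ≤ toℕ l →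
  restrict _≟_ k l (evenSwaps n) ≡ k ∷ l ∷ [] × restrict _≟_ k l (oddSwaps n) ≡ k ∷ l ∷ []
swaps-far {suc (suc n)} zero (suc (suc l)) _ =
  cong (zero ∷_) (trans (restrict-zero-suc {l = suc l} (oddSwaps (suc n)))
                        (cong (map suc) (proj₂ (swaps-once (suc l))))) ,
  cong (zero ∷_) (trans (restrict-zero-suc {l = suc l} (evenSwaps (suc n)))
                        (cong (map suc) (proj₁ (swaps-once (suc l)))))
swaps-far zero (suc zero) (s≤s ())
swaps-far (suc k) (suc l) (s≤s far) =
  trans restrict-evenSwaps-suc (cong (map suc) (proj₂ (swaps-far k l far))) ,
  trans restrict-oddSwaps-suc  (cong (map suc) (proj₁ (swaps-far k l far)))

swaps-consecutive : ∀ {n} (k l : Fin n) → toℕ l ≡ suc (toℕ k) →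
  Opposite k l (restrict _≟_ k l (evenSwaps n)) (restrict _≟_ k l (oddSwaps n))
swaps-consecutive {suc (suc n)} zero (suc zero) _ =
  subst₂ (Opposite zero (suc zero)) (sym even) (sym odd) ji-ij
  where
  even : restrict _≟_ zero (suc zero) (evenSwaps (suc (suc n))) ≡ suc zero ∷ zero ∷ []
  even = cong (λ r → suc zero ∷ zero ∷ r)
              (trans (restrict-zero-suc (map suc (evenSwaps n)))
                     (cong (map suc) (restrict-zero-zero (evenSwaps n))))
  odd : restrict _≟_ zero (suc zero) (oddSwaps (suc (suc n))) ≡ zero ∷ suc zero ∷ []
  odd = cong (zero ∷_) (trans (restrict-zero-suc (evenSwaps (suc n)))
                              (cong (map suc) (proj₁ (swaps-once zero))))
swaps-consecutive (suc k) (suc l) eq =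
  subst₂ (Opposite (suc k) (suc l)) (sym restrict-evenSwaps-suc) (sym restrict-oddSwaps-suc)
         (Opposite-map suc (Opposite-sym (swaps-consecutive k l (ℕ-suc-injective eq))))

module Representation (m : ℕ) where

  n : ℕ
  n = suc m

  last : Fin n
  last = fromℕ m

  R : V8 n → V8 n → List (V8 n) → List (V8 n)
  R = restrict _≟8_

  nums : List (Fin n) → List (V8 n)
  nums = map num

  layout : (List (V8 n) → List (V8 n)) → (B₁ B₂ B₃ B₄ : List (V8 n)) → List (List (V8 n))
  layout f B₁ B₂ B₃ B₄ =
    f (b ∷ d ∷ c ∷ []) ∷ B₁ ∷ f (b ∷ x ∷ a ∷ c ∷ []) ∷ B₂ ∷ f (d ∷ x ∷ a ∷ []) ∷ B₃ ∷
    f (b ∷ d ∷ x ∷ []) ∷ B₄ ∷ f (c ∷ a ∷ []) ∷ []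

  -- w = b d c n b x a c E d x a O b d x 1 c a, where E = evenSwaps n and O = oddSwaps n.
  w : List (V8 n)
  w = concat (layout id (num last ∷ []) (nums (evenSwaps n)) (nums (oddSwaps n)) (num zero ∷ []))

  skeleton : List (V8 n)
  skeleton = concat (layout id [] [] [] [])

  restrict-w : ∀ u v {ρ₁ ρ₂ ρ₃ ρ₄} →
    R u v (num last ∷ []) ≡ ρ₁ → R u v (nums (evenSwaps n)) ≡ ρ₂ → R u v (nums (oddSwaps n)) ≡ ρ₃ →
    R u v (num zero ∷ []) ≡ ρ₄ → R u v w ≡ concat (layout (R u v) ρ₁ ρ₂ ρ₃ ρ₄)
  restrict-w u v refl refl refl refl =
    restrict-concat _≟8_ u v
      (layout id (num last ∷ []) (nums (evenSwaps n)) (nums (oddSwaps n)) (num zero ∷ []))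

  RepresentsPair : V8 n → V8 n → Set
  RepresentsPair u v = Adj8 n u v ⇔ Alternate _≟8_ w u v

  represents-via : ∀ {u v} {l : List (V8 n)} →
                   R u v w ≡ l → (Adj8 n u v ⇔ (¬ HasSquare l)) → RepresentsPair u v
  represents-via {u} {v} eq = subst (λ l → Adj8 n u v ⇔ (¬ HasSquare l)) (sym eq)

  represents-sym : ∀ {u v} → RepresentsPair u v → RepresentsPair v u
  represents-sym {u} {v} h =
    mk⇔ (Alternate-sym _≟8_ {w} {u} {v} ∘ to h ∘ Sum.swap)
        (Sum.swap ∘ from h ∘ Alternate-sym _≟8_ {w} {v} {u})

  edge : ∀ {u v} {l : List (V8 n)} → Adj8 n u v → ¬ HasSquare l → Adj8 n u v ⇔ (¬ HasSquare l)
  edge e sf = mk⇔ (λ _ → sf) (λ _ → e)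

  non-edge : ∀ {u v} {l : List (V8 n)} → ¬ Adj8 n u v → HasSquare l → Adj8 n u v ⇔ (¬ HasSquare l)
  non-edge ¬e sq = mk⇔ (⊥-elim ∘ ¬e) (λ sf → ⊥-elim (sf sq))

  -- The implicit proofs are found by evaluating hasSquare?, which works once l is concrete enough.
  squareFree : ∀ {l : List (V8 n)} {_ : False (hasSquare? _≟8_ l)} → ¬ HasSquare l
  squareFree {_} {sf} = toWitnessFalse sf

  square : ∀ {l : List (V8 n)} {_ : True (hasSquare? _≟8_ l)} → HasSquare l
  square {_} {sq} = toWitness sq

  data Letter : V8 n → Set where
    a : Letter a
    b : Letter b
    c : Letter c
    d : Letter d
    x : Letter x

  data Kind : V8 n → Set where
    letter : ∀ {s} → Letter s → Kind s
    number : ∀ k → Kind (num k)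

  kind : ∀ v → Kind v
  kind a       = letter a
  kind b       = letter b
  kind c       = letter c
  kind d       = letter d
  kind x       = letter x
  kind (num k) = number k

  num≢letter : ∀ {s j} → Letter s → num j ≢ s
  num≢letter a ()
  num≢letter b ()
  num≢letter c ()
  num≢letter d ()
  num≢letter x ()

  num-injective : ∀ {j k : Fin n} → num j ≡ num k → j ≡ k
  num-injective refl = refl

  restrict-nums-letters : ∀ {s t} → Letter s → Letter t → ∀ ks → R s t (nums ks) ≡ []
  restrict-nums-letters ls lt = restrict-map-none _≟_ _≟8_ num λ _ → [ num≢letter ls , num≢letter lt ]

  restrict-nums-letter-number : ∀ {s} {k : Fin n} → Letter s → ∀ ks →
                                R s (num k) (nums ks) ≡ nums (restrict _≟_ k k ks)
  restrict-nums-letter-number ls = restrict-map _≟_ _≟8_ num λ _ →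
    mk⇔ [ ⊥-elim ∘ num≢letter ls , inj₁ ∘ num-injective ] [ inj₂ ∘ cong num , inj₂ ∘ cong num ]

  restrict-nums-numbers : ∀ {k l : Fin n} ks → R (num k) (num l) (nums ks) ≡ nums (restrict _≟_ k l ks)
  restrict-nums-numbers = restrict-map _≟_ _≟8_ num λ _ →
    mk⇔ (Sum.map num-injective num-injective) (Sum.map (cong num) (cong num))

  restrict-letters : ∀ {s t} → Letter s → Letter t → R s t w ≡ R s t skeleton
  restrict-letters {s} {t} ls lt =
    trans (restrict-w s t (none (last ∷ [])) (none (evenSwaps n)) (none (oddSwaps n)) (none (zero ∷ [])))
          (sym (restrict-concat _≟8_ s t (layout id [] [] [] [])))
    where none = restrict-nums-letters ls lt

  skeleton-represents : ∀ {s t} → Letter s → Letter t → s ≢ t → Adj8 n s t ⇔ Alternate _≟8_ skeleton s t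
  skeleton-represents a a a≢a = ⊥-elim (a≢a refl)
  skeleton-represents a b _   = non-edge [ (λ ()) , (λ ()) ] square
  skeleton-represents a c _   = edge (inj₁ ac) squareFree
  skeleton-represents a d _   = edge (inj₁ ad) squareFree
  skeleton-represents a x _   = edge (inj₂ xa) squareFree
  skeleton-represents b a _   = non-edge [ (λ ()) , (λ ()) ] square
  skeleton-represents b b b≢b = ⊥-elim (b≢b refl)
  skeleton-represents b c _   = edge (inj₁ bc) squareFree
  skeleton-represents b d _   = edge (inj₁ bd) squareFree
  skeleton-represents b x _   = non-edge [ (λ ()) , (λ ()) ] square
  skeleton-represents c a _   = edge (inj₂ ac) squareFree
  skeleton-represents c b _   = edge (inj₂ bc) squareFree
  skeleton-represents c c c≢c = ⊥-elim (c≢c refl)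
  skeleton-represents c d _   = non-edge [ (λ ()) , (λ ()) ] square
  skeleton-represents c x _   = non-edge [ (λ ()) , (λ ()) ] square
  skeleton-represents d a _   = edge (inj₂ ad) squareFree
  skeleton-represents d b _   = edge (inj₂ bd) squareFree
  skeleton-represents d c _   = non-edge [ (λ ()) , (λ ()) ] square
  skeleton-represents d d d≢d = ⊥-elim (d≢d refl)
  skeleton-represents d x _   = edge (inj₂ xd) squareFree
  skeleton-represents x a _   = edge (inj₁ xa) squareFree
  skeleton-represents x b _   = non-edge [ (λ ()) , (λ ()) ] square
  skeleton-represents x c _   = non-edge [ (λ ()) , (λ ()) ] square
  skeleton-represents x d _   = edge (inj₁ xd) squareFree
  skeleton-represents x x x≢x = ⊥-elim (x≢x refl)

  a-adjacent : ∀ {k : Fin n} → num zero ≢ num k → Adj8 n a (num k)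
  a-adjacent {zero}  0≢k = ⊥-elim (0≢k refl)
  a-adjacent {suc k} _   = inj₁ (ai (s≤s (s≤s z≤n)))

  a-zero-nonadjacent : ¬ Adj8 n a (num zero)
  a-zero-nonadjacent (inj₁ (ai (s≤s ())))
  a-zero-nonadjacent (inj₂ ())

  below-last : ∀ {k : Fin n} → num last ≢ num k → toℕ k < m
  below-last {k} last≢k = ≤∧≢⇒< (toℕ≤pred[n] k) λ eq →
    last≢k (cong num (toℕ-injective (trans (toℕ-fromℕ m) (sym eq))))

  d-adjacent : ∀ {k : Fin n} → num last ≢ num k → Adj8 n d (num k)
  d-adjacent {k} last≢k = inj₁ (di (subst (_≤ n) (+-comm 1 (suc (toℕ k))) (s≤s (below-last last≢k))))

  d-last-nonadjacent : ¬ Adj8 n d (num last)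
  d-last-nonadjacent (inj₁ (di h)) = m+1+n≰m n (subst (λ t → 1 + t + 1 ≤ n) (toℕ-fromℕ m) h)
  d-last-nonadjacent (inj₂ ())

  letter-singleton : ∀ {s} → Letter s → ∀ j k →
    (num j ≡ num k × R s (num k) (num j ∷ []) ≡ num k ∷ []) ⊎
    (num j ≢ num k × R s (num k) (num j ∷ []) ≡ [])
  letter-singleton ls j k = restrict-singleton _≟8_ (num j) (num≢letter ls)

  letter-number-via : ∀ {s k ρL ρT} → Letter s →
    R s (num k) (num last ∷ []) ≡ ρL → R s (num k) (num zero ∷ []) ≡ ρT →
    (Adj8 n s (num k) ⇔ (¬ HasSquare (concat (layout (R s (num k)) ρL (num k ∷ []) (num k ∷ []) ρT)))) →
    RepresentsPair s (num k)
  letter-number-via {s} {k} ls eL eT = represents-via (restrict-w s (num k) eL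
    (trans (restrict-nums-letter-number ls (evenSwaps n)) (cong nums (proj₁ (swaps-once k))))
    (trans (restrict-nums-letter-number ls (oddSwaps n))  (cong nums (proj₂ (swaps-once k))))
    eT)

  letter-number : ∀ {s} → Letter s → ∀ k → RepresentsPair s (num k)
  letter-number a k with letter-singleton a zero k
  ... | inj₁ (refl , eT) =
    letter-number-via a refl eT
      (non-edge a-zero-nonadjacent (HasSquare-++⁺ʳ _ (there (there (there here)))))
  ... | inj₂ (0≢k , eT) =
    letter-number-via a refl eT (edge (a-adjacent 0≢k)
      (padded-ijiji-squareFree (λ ()) (Sum.map proj₂ proj₂ (letter-singleton a last k)) (inj₂ refl)))
  -- b and c do not occur between E and O, so the occurrences of num k in E and O form a square.
  letter-number b k =
    letter-number-via b refl refl (non-edge [ (λ ()) , (λ ()) ] (there (HasSquare-++⁺ʳ _ (there here))))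
  letter-number c k =
    letter-number-via c refl refl (non-edge [ (λ ()) , (λ ()) ] (there (HasSquare-++⁺ʳ _ (there here))))
  letter-number d k with letter-singleton d last k
  ... | inj₁ (refl , eL) = letter-number-via d eL refl (non-edge d-last-nonadjacent (there here))
  ... | inj₂ (last≢k , eL) =
    letter-number-via d eL refl (edge (d-adjacent last≢k)
      (padded-ijiji-squareFree (λ ()) (inj₂ refl) (Sum.map proj₂ proj₂ (letter-singleton d zero k))))
  letter-number x k =
    letter-number-via x refl refl (edge (inj₁ xi)
      (padded-ijiji-squareFree (λ ()) (Sum.map proj₂ proj₂ (letter-singleton x last k))
                                      (Sum.map proj₂ proj₂ (letter-singleton x zero k))))

  far-adjacent : ∀ {k l : Fin n} → 2 + toℕ k ≤ toℕ l → Adj8 n (num k) (num l)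
  far-adjacent far = inj₁ (ij (inj₁ (s≤s far)))

  consecutive-not-far : ∀ i → ¬ Far i (suc i)
  consecutive-not-far i = [ 1+n≰n , 1+n≰n ∘ m+n≤o⇒n≤o 2 ]

  consecutive-nonadjacent : ∀ {k l : Fin n} → toℕ l ≡ suc (toℕ k) → ¬ Adj8 n (num k) (num l)
  consecutive-nonadjacent {k} eq (inj₁ (ij far)) =
    consecutive-not-far (lab k) (subst (λ t → Far (lab k) (1 + t)) eq far)
  consecutive-nonadjacent {k} eq (inj₂ (ij far)) =
    consecutive-not-far (lab k) (Sum.swap (subst (λ t → Far (1 + t) (lab k)) eq far))

  numbers-via : ∀ {k l : Fin n} {ρE ρO} →
    restrict _≟_ k l (evenSwaps n) ≡ ρE → restrict _≟_ k l (oddSwaps n) ≡ ρO →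
    let ρL = R (num k) (num l) (num last ∷ []) ; ρT = R (num k) (num l) (num zero ∷ []) in
    (Adj8 n (num k) (num l) ⇔ (¬ HasSquare (concat (ρL ∷ nums ρE ∷ nums ρO ∷ ρT ∷ [])))) →
    RepresentsPair (num k) (num l)
  numbers-via {k} {l} eE eO = represents-via (restrict-w (num k) (num l) refl
    (trans (restrict-nums-numbers {k} {l} (evenSwaps n)) (cong nums eE))
    (trans (restrict-nums-numbers {k} {l} (oddSwaps n))  (cong nums eO))
    refl)

  last≢lower : ∀ {k l : Fin n} → toℕ k < toℕ l → num last ≢ num k
  last≢lower {l = l} k<l refl =
    1+n≰n (≤-trans (subst (λ t → 1 + t ≤ toℕ l) (toℕ-fromℕ m) k<l) (toℕ≤pred[n] l))

  zero≢upper : ∀ {k l : Fin n} → toℕ k < toℕ l → num zero ≢ num l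
  zero≢upper () refl

  far⇒≢ : ∀ {k l : Fin n} → 2 + toℕ k ≤ toℕ l → num k ≢ num l
  far⇒≢ far refl = 1+n≰n (m+n≤o⇒n≤o 1 far)

  numbers-far : ∀ {k l : Fin n} → 2 + toℕ k ≤ toℕ l → RepresentsPair (num k) (num l)
  numbers-far {k} {l} far =
    numbers-via (proj₁ (swaps-far k l far)) (proj₂ (swaps-far k l far)) (edge (far-adjacent far)
      (padded-ijij-squareFree (far⇒≢ far)
        (Sum.map proj₂ proj₂ (restrict-singleton _≟8_ (num last) (last≢lower k<l)))
        (Sum.map proj₂ proj₂ (restrict-singleton′ _≟8_ (num zero) (zero≢upper k<l)))))
    where
    k<l : toℕ k < toℕ l
    k<l = <⇒≤ far

  numbers-consecutive : ∀ {k l : Fin n} → toℕ l ≡ suc (toℕ k) → RepresentsPair (num k) (num l)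
  numbers-consecutive {k} {l} eq =
    numbers-via refl refl (non-edge (consecutive-nonadjacent eq)
      (HasSquare-++⁺ʳ (R (num k) (num l) (num last ∷ []))
        (Opposite⇒square (Opposite-map num (swaps-consecutive k l eq)) _)))

  numbers-ordered : ∀ {k l : Fin n} → toℕ k < toℕ l → RepresentsPair (num k) (num l)
  numbers-ordered k<l with m≤n⇒m<n∨m≡n k<l
  ... | inj₁ far         = numbers-far far
  ... | inj₂ consecutive = numbers-consecutive (sym consecutive)

  numbers : ∀ k l → k ≢ l → RepresentsPair (num k) (num l)
  numbers k l k≢l with <-cmp k l
  ... | tri< k<l _ _ = numbers-ordered k<l
  ... | tri≈ _ k≡l _ = ⊥-elim (k≢l k≡l)
  ... | tri> _ _ l<k = represents-sym (numbers-ordered l<k)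

  represents : ∀ u v → u ≢ v → RepresentsPair u v
  represents u v u≢v with kind u | kind v
  ... | letter ls | letter lt = represents-via (restrict-letters ls lt) (skeleton-represents ls lt u≢v)
  ... | letter ls | number k  = letter-number ls k
  ... | number k  | letter lt = represents-sym (letter-number lt k)
  ... | number k  | number l  = numbers k l (u≢v ∘ cong num)

theorem8 : (n : ℕ) → 1 ≤ n → WordRepresentable (V8 n) _≟8_ (Adj8 n)
theorem8 (suc m) _ = w , represents
  where open Representation m
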